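{- Let $G=(V,E)$ be a finite simple graph and $u\in V$. Then \[ D(G,x)=D(G-u,x)+D(G\triangle u,x)-D((G\triangle u)-u,x). \]
   Context: The domination polynomial of $G=(V,E)$ is $D(G,x)=\sum_{W\subseteq V,\ N_G[W]=V}x^{|W|}$, where $N_G[W]$ is the closed neighborhood of $W$; the graph with no vertices has $D=1$. Graph operations: - $G-u$ deletes $u$. - $G\triangle u$ is the graph obtained from $G$ by removing every edge both of whose endpoints are neighbors of $u$; the vertex $u$ is not removed. -}

module Defs where

open import Data.Nat using (ℕ; zero; suc; _≡ᵇ_)
open import Data.Bool using (Bool; true; false; _∧_; _∨_; not; if_then_else_)
open import Data.Bool.Properties using (∧-comm)
open import Data.Fin using (Fin; punchIn)
open import Data.Fin.Subset using (Subset; _∈_; ∣_∣)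
open import Data.Vec using (Vec; []; _∷_; lookup)
open import Data.List using (List; []; _∷_; _++_; map; filterᵇ; length; allFin)
open import Data.Bool.ListAction using (any; all)
open import Data.Integer using (ℤ; +_)
open import Relation.Binary.PropositionalEquality using (_≡_; refl; cong₂)

record Graph (n : ℕ) : Set where
  field
    adj   : Fin n → Fin n → Bool
    sym   : ∀ a b → adj a b ≡ adj b a
    irref : ∀ a → adj a a ≡ false
open Graph public

-- G - u : delete vertex u from a graph on Fin (suc n); vertices of the
-- result are relabelled via punchIn u (order-preserving bijection onto V∖{u}).
_─_ : ∀ {n} → Graph (suc n) → Fin (suc n) → Graph n
adj   (G ─ u) a b = adj G (punchIn u a) (punchIn u b)
sym   (G ─ u) a b = sym G (punchIn u a) (punchIn u b)
irref (G ─ u) a   = irref G (punchIn u a)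

_△_ : ∀ {n} → Graph n → Fin n → Graph n
adj   (G △ u) a b = adj G a b ∧ not (adj G u a ∧ adj G u b)
sym   (G △ u) a b = cong₂ (λ x y → x ∧ not y) (sym G a b) (∧-comm (adj G u a) (adj G u b))
irref (G △ u) a rewrite irref G a = refl

allSubsets : ∀ n → List (Subset n)
allSubsets zero    = [] ∷ []
allSubsets (suc n) = map (true ∷_) (allSubsets n) ++ map (false ∷_) (allSubsets n)

inSet : ∀ {n} → Subset n → Fin n → Bool
inSet W v = lookup W v

isDominating : ∀ {n} → Graph n → Subset n → Bool
isDominating {n} G W =
  all (λ v → inSet W v ∨ any (λ w → inSet W w ∧ adj G w v) (allFin n)) (allFin n)

domCount : ∀ {n} → Graph n → ℕ → ℕ
domCount {n} G k = length (filterᵇ (λ W → isDominating G W ∧ (∣ W ∣ ≡ᵇ k)) (allSubsets n))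

-- the domination polynomial D(G,x), represented by its coefficient sequence
-- (coefficient of x^k), with integer coefficients
D : ∀ {n} → Graph n → ℕ → ℤ
D G k = + domCount G k

module Submission where

-- Deletion–contraction-type recurrence for the domination polynomial:
--   D(G) = D(G - u) + D(G △ u) - D((G △ u) - u),
-- proved coefficientwise as the natural-number identity
--   D_k(G) + D_k((G △ u) - u) = D_k(G - u) + D_k(G △ u).
--
-- Split the vertex subsets of G according to whether they contain u.
--  (A) A set containing u dominates G iff it dominates G △ u: every edge
--      removed by △ joins two neighbours of u, which u dominates anyway.
--  (B) A set W ⊆ V ∖ {u} dominates G iff W dominates G - u and W meets N(u).
--  (C) If W ⊆ V ∖ {u} misses N(u), then W dominates G - u iff it dominates
--      (G △ u) - u, since every removed edge has both ends outside W.
-- Both D_k(X) and D_k(X - u) thus decompose into three counts, two of which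
-- are unchanged when X = G is replaced by G △ u; the theorem is the
-- resulting balance of the four decompositions.

open import Defs hiding (sym)
open import Data.Nat as ℕ using (ℕ; suc; _≡ᵇ_)
open import Data.Nat.Properties using (+-comm; +-suc; +-commutativeSemigroup; m≤n+m; m+n∸n≡m)
open import Algebra.Properties.CommutativeSemigroup +-commutativeSemigroup using (interchange)
open import Data.Fin as Fin using (Fin; punchIn; punchOut)
open import Data.Fin.Properties using (punchIn-punchOut) renaming (_≟_ to _≟ᶠ_)
open import Data.Fin.Subset using (Subset; ∣_∣)
open import Data.Integer using (+_; _+_; _-_; _⊖_)
open import Data.Integer.Properties using (pos-+; [+m]-[+n]≡m⊖n; ⊖-≥)
open import Data.Bool using (Bool; true; false; T; _∧_; not)
open import Data.Bool.Properties using (T-∧; T-∨; ∧-identityʳ; ∧-zeroʳ; ∧-assoc; ∧-comm)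
open import Data.Vec using (_∷_; lookup; insertAt)
open import Data.Vec.Properties using (insertAt-lookup; insertAt-punchIn)
open import Data.List using (List; []; _∷_; _++_; map; filterᵇ; length; allFin)
open import Data.List.Properties using (length-++; filter-++; filter-≐; map-cong)
open import Data.List.Relation.Unary.All.Properties as All using (all⁺; all⁻)
open import Data.List.Relation.Unary.Any.Properties as Any using (any⁺; any⁻)
open import Data.Bool.ListAction using (any; all; or)
open import Data.Product as Product using (∃-syntax; _×_; _,_; proj₁)
open import Data.Sum as Sum using (_⊎_; inj₁; inj₂; [_,_])
open import Data.Unit using (tt)
open import Data.Empty using (⊥-elim)
open import Function using (_⇔_; mk⇔; Equivalence; _∘_)
open import Relation.Nullary using (¬_; yes; no)
open import Relation.Nullary.Decidable using (T?)
open import Relation.Binary.PropositionalEquality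
  using (_≡_; refl; sym; trans; cong; cong₂; subst; module ≡-Reasoning)

open Equivalence using (to; from)

T-⇔⇒≡ : ∀ {x y} → T x ⇔ T y → x ≡ y
T-⇔⇒≡ {false} {false} _ = refl
T-⇔⇒≡ {false} {true}  e = ⊥-elim (from e tt)
T-⇔⇒≡ {true}  {false} e = ⊥-elim (to e tt)
T-⇔⇒≡ {true}  {true}  _ = refl

∧-not-cong : ∀ {x y} b → (b ≡ false → x ≡ y) → x ∧ not b ≡ y ∧ not b
∧-not-cong {x} {y} true  _ = trans (∧-zeroʳ x) (sym (∧-zeroʳ y))
∧-not-cong         false h = cong (_∧ true) (h refl)

∧-swapʳ : ∀ a b c → (a ∧ b) ∧ c ≡ (a ∧ c) ∧ b
∧-swapʳ a b c = trans (∧-assoc a b c) (trans (cong (a ∧_) (∧-comm b c)) (sym (∧-assoc a c b)))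

all-allFin⇔ : ∀ {n} (p : Fin n → Bool) → T (all p (allFin n)) ⇔ (∀ i → T (p i))
all-allFin⇔ p = mk⇔ (All.tabulate⁻ ∘ all⁺ p _) (all⁻ p ∘ All.tabulate⁺)

any-allFin⇔ : ∀ {n} (p : Fin n → Bool) → T (any p (allFin n)) ⇔ (∃[ i ] T (p i))
any-allFin⇔ p = mk⇔ (Any.tabulate⁻ ∘ any⁻ p _) (λ (i , pᵢ) → any⁺ p (Any.tabulate⁺ i pᵢ))

count : ∀ {A : Set} → (A → Bool) → List A → ℕ
count p xs = length (filterᵇ p xs)

count-++ : ∀ {A : Set} (p : A → Bool) xs ys → count p (xs ++ ys) ≡ count p xs ℕ.+ count p ys
count-++ p xs ys = trans (cong length (filter-++ (T? ∘ p) xs ys)) (length-++ (filterᵇ p xs))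

count-map : ∀ {A B : Set} (p : B → Bool) (f : A → B) xs → count p (map f xs) ≡ count (p ∘ f) xs
count-map p f []       = refl
count-map p f (x ∷ xs) with p (f x)
... | true  = cong suc (count-map p f xs)
... | false = count-map p f xs

count-cong : ∀ {A : Set} {p q : A → Bool} → (∀ x → p x ≡ q x) → ∀ xs → count p xs ≡ count q xs
count-cong {p = p} {q} p≗q xs =
  cong length (filter-≐ (T? ∘ p) (T? ∘ q) ((λ {x} → subst T (p≗q x)) , (λ {x} → subst T (sym (p≗q x)))) xs)

count-split : ∀ {A : Set} (p q : A → Bool) xs →
  count p xs ≡ count (λ x → p x ∧ q x) xs ℕ.+ count (λ x → p x ∧ not (q x)) xs
count-split p q []       = refl
count-split p q (x ∷ xs) with p x | q x
... | true  | true  = cong suc (count-split p q xs)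
... | true  | false = trans (cong suc (count-split p q xs)) (sym (+-suc _ _))
... | false | _     = count-split p q xs

count-subsets-head : ∀ {n} (p : Subset (suc n) → Bool) →
  count p (allSubsets (suc n))
    ≡ count (λ W → p (true ∷ W)) (allSubsets n) ℕ.+ count (λ W → p (false ∷ W)) (allSubsets n)
count-subsets-head {n} p =
  trans (count-++ p (map (true ∷_) (allSubsets n)) _)
        (cong₂ ℕ._+_ (count-map p (true ∷_) (allSubsets n)) (count-map p (false ∷_) (allSubsets n)))

-- Subsets of Fin (suc n) split by membership of an arbitrary vertex u: those
-- containing u, resp. avoiding u, are the sets insertAt W u true, resp. false.
count-subsets-at : ∀ {n} (u : Fin (suc n)) (p : Subset (suc n) → Bool) →
  count p (allSubsets (suc n))
    ≡ count (λ W → p (insertAt W u true)) (allSubsets n) ℕ.+ count (λ W → p (insertAt W u false)) (allSubsets n)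
count-subsets-at         Fin.zero    p = count-subsets-head p
count-subsets-at {suc n} (Fin.suc u) p = begin
  count p (allSubsets (suc (suc n)))
    ≡⟨ count-subsets-head p ⟩
  count (p ∘ (true ∷_)) S⁺ ℕ.+ count (p ∘ (false ∷_)) S⁺
    ≡⟨ cong₂ ℕ._+_ (count-subsets-at u (p ∘ (true ∷_))) (count-subsets-at u (p ∘ (false ∷_))) ⟩
  (c true true ℕ.+ c true false) ℕ.+ (c false true ℕ.+ c false false)
    ≡⟨ interchange (c true true) (c true false) (c false true) (c false false) ⟩
  (c true true ℕ.+ c false true) ℕ.+ (c true false ℕ.+ c false false)
    ≡⟨ sym (cong₂ ℕ._+_ (count-subsets-head (λ W → p (insertAt W (Fin.suc u) true)))
                          (count-subsets-head (λ W → p (insertAt W (Fin.suc u) false)))) ⟩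
  count (λ W → p (insertAt W (Fin.suc u) true)) S⁺ ℕ.+ count (λ W → p (insertAt W (Fin.suc u) false)) S⁺ ∎
  where
  open ≡-Reasoning
  S⁺ = allSubsets (suc n)
  c : Bool → Bool → ℕ
  c x b = count (λ W → p (x ∷ insertAt W u b)) (allSubsets n)

size-insertAt-false : ∀ {n} (W : Subset n) u → ∣ insertAt W u false ∣ ≡ ∣ W ∣
size-insertAt-false W           Fin.zero    = refl
size-insertAt-false (true ∷ W)  (Fin.suc u) = cong suc (size-insertAt-false W u)
size-insertAt-false (false ∷ W) (Fin.suc u) = size-insertAt-false W u

Dominated : ∀ {m} → Graph m → Subset m → Fin m → Set
Dominated G W v = T (lookup W v) ⊎ ∃[ w ] (T (lookup W w) × T (adj G w v))

Dominates : ∀ {m} → Graph m → Subset m → Set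
Dominates G W = ∀ v → Dominated G W v

isDominating⇔ : ∀ {m} (G : Graph m) W → T (isDominating G W) ⇔ Dominates G W
isDominating⇔ G W = mk⇔
  (λ h v → Sum.map₂ (Product.map₂ (to T-∧) ∘ to (any-allFin⇔ _)) (to T-∨ (to (all-allFin⇔ _) h v)))
  (λ d → from (all-allFin⇔ _) λ v → from T-∨ (Sum.map₂ (from (any-allFin⇔ _) ∘ Product.map₂ (from T-∧)) (d v)))

isDominating-cong : ∀ {m m′} (G : Graph m) W (H : Graph m′) W′ →
  Dominates G W ⇔ Dominates H W′ → isDominating G W ≡ isDominating H W′
isDominating-cong G W H W′ e = T-⇔⇒≡ (mk⇔
  (from (isDominating⇔ H W′) ∘ to e ∘ to (isDominating⇔ G W))
  (from (isDominating⇔ G W) ∘ from e ∘ to (isDominating⇔ H W′)))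

dominates-mono : ∀ {m} (G H : Graph m) W →
  (∀ {w v} → T (lookup W w) → T (adj G w v) → T (adj H w v)) → Dominates G W → Dominates H W
dominates-mono G H W keep d v = Sum.map₂ (λ (w , w∈W , e) → w , w∈W , keep w∈W e) (d v)

△-⊆ : ∀ {m} (G : Graph m) u {a b} → T (adj (G △ u) a b) → T (adj G a b)
△-⊆ G u = proj₁ ∘ to T-∧

-- No edge at u is removed (u is not its own neighbour).
△-adj-u : ∀ {m} (G : Graph m) u v → adj (G △ u) u v ≡ adj G u v
△-adj-u G u v rewrite irref G u = ∧-identityʳ (adj G u v)

△-keeps : ∀ {m} (G : Graph m) u {a b} →
  T (adj G a b) → ¬ T (adj G u a) ⊎ ¬ T (adj G u b) → T (adj (G △ u) a b)
△-keeps G u {a} {b} e outside with adj G u a | adj G u b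
... | false | _     = from T-∧ (e , tt)
... | true  | false = from T-∧ (e , tt)
... | true  | true  = ⊥-elim ([ (λ f → f tt) , (λ f → f tt) ] outside)

-- (A) A set containing u dominates G iff it dominates G △ u: a vertex that
-- lost its dominating edge is a neighbour of u.
dominates-△-containing : ∀ {m} (G : Graph m) u W → T (lookup W u) →
  Dominates G W ⇔ Dominates (G △ u) W
dominates-△-containing G u W u∈W = mk⇔ forward (dominates-mono (G △ u) G W (λ _ → △-⊆ G u))
  where
  forward : Dominates G W → Dominates (G △ u) W
  forward d v with d v
  ... | inj₁ v∈W = inj₁ v∈W
  ... | inj₂ (w , w∈W , e) with T? (adj G u v)
  ...   | yes uv  = inj₂ (u , u∈W , subst T (sym (△-adj-u G u v)) uv)
  ...   | no  ¬uv = inj₂ (w , w∈W , △-keeps G u e (inj₂ ¬uv))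

-- Subsets of V ∖ {u} are indexed by Fin n through punchIn u.  Such a W
-- touches u when it contains a neighbour of u.
Touches : ∀ {n} → Graph (suc n) → Fin (suc n) → Subset n → Set
Touches X u W = ∃[ j ] (T (lookup W j) × T (adj X u (punchIn u j)))

touches : ∀ {n} → Graph (suc n) → Fin (suc n) → Subset n → Bool
touches {n} X u W = any (λ j → lookup W j ∧ adj X u (punchIn u j)) (allFin n)

touches⇔ : ∀ {n} (X : Graph (suc n)) u W → T (touches X u W) ⇔ Touches X u W
touches⇔ X u W = mk⇔
  (Product.map₂ (to T-∧) ∘ to (any-allFin⇔ _))
  (from (any-allFin⇔ _) ∘ Product.map₂ (from T-∧))

touches-△ : ∀ {n} (G : Graph (suc n)) u W → touches (G △ u) u W ≡ touches G u W
touches-△ {n} G u W = cong or (map-cong (λ j → cong (lookup W j ∧_) (△-adj-u G u (punchIn u j))) (allFin n))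

vertex-cases : ∀ {n} (u v : Fin (suc n)) → v ≡ u ⊎ ∃[ j ] v ≡ punchIn u j
vertex-cases u v with v ≟ᶠ u
... | yes v≡u = inj₁ v≡u
... | no  v≢u = inj₂ (punchOut (v≢u ∘ sym) , sym (punchIn-punchOut (v≢u ∘ sym)))

dominates-avoiding : ∀ {n} (X : Graph (suc n)) u (W : Subset n) →
  Dominates X (insertAt W u false) ⇔ (Dominates (X ─ u) W × Touches X u W)
dominates-avoiding X u W = mk⇔ forward backward
  where
  W⁺ : Subset _
  W⁺ = insertAt W u false

  u∉W⁺ : ¬ T (lookup W⁺ u)
  u∉W⁺ = subst T (insertAt-lookup W u false)

  lift : ∀ {j} → T (lookup W j) → T (lookup W⁺ (punchIn u j))
  lift {j} = subst T (sym (insertAt-punchIn W u false j))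

  members : ∀ {w} → T (lookup W⁺ w) → ∃[ j ] (w ≡ punchIn u j × T (lookup W j))
  members {w} w∈W⁺ with vertex-cases u w
  ... | inj₁ refl       = ⊥-elim (u∉W⁺ w∈W⁺)
  ... | inj₂ (j , refl) = j , refl , subst T (insertAt-punchIn W u false j) w∈W⁺

  forward : Dominates X W⁺ → Dominates (X ─ u) W × Touches X u W
  forward d = restricted , touching
    where
    restricted : Dominates (X ─ u) W
    restricted j with d (punchIn u j)
    ... | inj₁ j∈W⁺ = inj₁ (subst T (insertAt-punchIn W u false j) j∈W⁺)
    ... | inj₂ (w , w∈W⁺ , e) with members w∈W⁺
    ...   | i , refl , i∈W = inj₂ (i , i∈W , e)

    touching : Touches X u W
    touching with d u
    ... | inj₁ u∈W⁺ = ⊥-elim (u∉W⁺ u∈W⁺)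
    ... | inj₂ (w , w∈W⁺ , e) with members w∈W⁺
    ...   | i , refl , i∈W = i , i∈W , subst T (Graph.sym X (punchIn u i) u) e

  backward : Dominates (X ─ u) W × Touches X u W → Dominates X W⁺
  backward (d , (i , i∈W , e)) v with vertex-cases u v
  ... | inj₁ refl = inj₂ (punchIn u i , lift i∈W , subst T (Graph.sym X u (punchIn u i)) e)
  ... | inj₂ (j , refl) with d j
  ...   | inj₁ j∈W = inj₁ (lift j∈W)
  ...   | inj₂ (w , w∈W , e′) = inj₂ (punchIn u w , lift w∈W , e′)

-- (C) If W ⊆ V ∖ {u} does not touch u, then W dominates G - u iff it
-- dominates (G △ u) - u: no edge leaving W is removed.
dominates-△-missing : ∀ {n} (G : Graph (suc n)) u (W : Subset n) → ¬ Touches G u W →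
  Dominates (G ─ u) W ⇔ Dominates ((G △ u) ─ u) W
dominates-△-missing G u W misses = mk⇔
  (dominates-mono (G ─ u) ((G △ u) ─ u) W (λ {w} w∈W e → △-keeps G u e (inj₁ (λ uw → misses (w , w∈W , uw)))))
  (dominates-mono ((G △ u) ─ u) (G ─ u) W (λ _ → △-⊆ G u))

module Decomposition {n} (u : Fin (suc n)) (k : ℕ) where
  open ≡-Reasoning

  subsets : List (Subset n)
  subsets = allSubsets n

  ofSizeK : Subset n → Bool
  ofSizeK W = ∣ W ∣ ≡ᵇ k

  containingU : Graph (suc n) → ℕ
  containingU X = count (λ W → isDominating X (insertAt W u true) ∧ (∣ insertAt W u true ∣ ≡ᵇ k)) subsets

  touchingN missingN : Graph (suc n) → ℕ
  touchingN X = count (λ W → (isDominating (X ─ u) W ∧ ofSizeK W) ∧ touches X u W) subsets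
  missingN  X = count (λ W → (isDominating (X ─ u) W ∧ ofSizeK W) ∧ not (touches X u W)) subsets

  -- By (B), the dominating k-sets of X avoiding u are the touching ones.
  domCount-split : ∀ X → domCount X k ≡ containingU X ℕ.+ touchingN X
  domCount-split X =
    trans (count-subsets-at u (λ W → isDominating X W ∧ (∣ W ∣ ≡ᵇ k)))
          (cong (containingU X ℕ.+_) (count-cong avoidingU subsets))
    where
    avoidingU : ∀ W → isDominating X (insertAt W u false) ∧ (∣ insertAt W u false ∣ ≡ᵇ k)
                    ≡ (isDominating (X ─ u) W ∧ ofSizeK W) ∧ touches X u W
    avoidingU W = begin
      isDominating X (insertAt W u false) ∧ (∣ insertAt W u false ∣ ≡ᵇ k)
        ≡⟨ cong₂ (λ d s → d ∧ (s ≡ᵇ k)) avoidingU-dominates (size-insertAt-false W u) ⟩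
      (isDominating (X ─ u) W ∧ touches X u W) ∧ ofSizeK W
        ≡⟨ ∧-swapʳ (isDominating (X ─ u) W) (touches X u W) (ofSizeK W) ⟩
      (isDominating (X ─ u) W ∧ ofSizeK W) ∧ touches X u W ∎
      where
      avoidingU-dominates : isDominating X (insertAt W u false) ≡ isDominating (X ─ u) W ∧ touches X u W
      avoidingU-dominates = T-⇔⇒≡ (mk⇔
        (λ h → let d , t = to (dominates-avoiding X u W) (to (isDominating⇔ X (insertAt W u false)) h)
               in from T-∧ (from (isDominating⇔ (X ─ u) W) d , from (touches⇔ X u W) t))
        (λ h → let d , t = to T-∧ h
               in from (isDominating⇔ X (insertAt W u false)) (from (dominates-avoiding X u W)
                    (to (isDominating⇔ (X ─ u) W) d , to (touches⇔ X u W) t))))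

  domCount-deleted-split : ∀ X → domCount (X ─ u) k ≡ touchingN X ℕ.+ missingN X
  domCount-deleted-split X = count-split (λ W → isDominating (X ─ u) W ∧ ofSizeK W) (touches X u) subsets

  -- By (A).
  containingU-△ : ∀ G → containingU G ≡ containingU (G △ u)
  containingU-△ G = count-cong (λ W → cong (_∧ (∣ insertAt W u true ∣ ≡ᵇ k))
    (isDominating-cong G (insertAt W u true) (G △ u) (insertAt W u true) (dominates-△-containing G u (insertAt W u true)
                          (subst T (sym (insertAt-lookup W u true)) tt))))
    subsets

  -- By (C), together with N_G(u) = N_{G △ u}(u).
  missingN-△ : ∀ G → missingN G ≡ missingN (G △ u)
  missingN-△ G = count-cong missing subsets
    where
    missing : ∀ W → (isDominating (G ─ u) W ∧ ofSizeK W) ∧ not (touches G u W)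
                  ≡ (isDominating ((G △ u) ─ u) W ∧ ofSizeK W) ∧ not (touches (G △ u) u W)
    missing W = begin
      (isDominating (G ─ u) W ∧ ofSizeK W) ∧ not (touches G u W)
        ≡⟨ ∧-not-cong (touches G u W) (cong (_∧ ofSizeK W) ∘ missing-dominates) ⟩
      (isDominating ((G △ u) ─ u) W ∧ ofSizeK W) ∧ not (touches G u W)
        ≡⟨ cong (λ b → (isDominating ((G △ u) ─ u) W ∧ ofSizeK W) ∧ not b) (sym (touches-△ G u W)) ⟩
      (isDominating ((G △ u) ─ u) W ∧ ofSizeK W) ∧ not (touches (G △ u) u W) ∎
      where
      missing-dominates : touches G u W ≡ false → isDominating (G ─ u) W ≡ isDominating ((G △ u) ─ u) W
      missing-dominates misses = isDominating-cong (G ─ u) W ((G △ u) ─ u) W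
        (dominates-△-missing G u W (λ t → subst T misses (from (touches⇔ G u W) t)))

balance⇒difference : ∀ a b c d → a ℕ.+ d ≡ b ℕ.+ c → + a ≡ (+ b + + c) - + d
balance⇒difference a b c d balance = sym (begin
  (+ b + + c) - + d      ≡⟨ cong (_- + d) (sym (pos-+ b c)) ⟩
  + (b ℕ.+ c) - + d      ≡⟨ cong (λ x → + x - + d) (sym balance) ⟩
  + (a ℕ.+ d) - + d      ≡⟨ [+m]-[+n]≡m⊖n (a ℕ.+ d) d ⟩
  (a ℕ.+ d) ⊖ d          ≡⟨ ⊖-≥ (m≤n+m d a) ⟩
  + (a ℕ.+ d ℕ.∸ d)      ≡⟨ cong +_ (m+n∸n≡m a d) ⟩
  + a                    ∎)
  where open ≡-Reasoning

mainTheorem16 : ∀ {n} (G : Graph (suc n)) (u : Fin (suc n)) (k : ℕ) →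
    D G k ≡ (D (G ─ u) k + D (G △ u) k) - D ((G △ u) ─ u) k
mainTheorem16 G u k =
  balance⇒difference (domCount G k) (domCount (G ─ u) k) (domCount H k) (domCount (H ─ u) k) balance
  where
  open Decomposition u k
  open ≡-Reasoning
  H = G △ u

  balance : domCount G k ℕ.+ domCount (H ─ u) k ≡ domCount (G ─ u) k ℕ.+ domCount H k
  balance = begin
    domCount G k ℕ.+ domCount (H ─ u) k
      ≡⟨ cong₂ ℕ._+_ (domCount-split G) (domCount-deleted-split H) ⟩
    (containingU G ℕ.+ touchingN G) ℕ.+ (touchingN H ℕ.+ missingN H)
      ≡⟨ cong₂ (λ x y → (x ℕ.+ touchingN G) ℕ.+ (touchingN H ℕ.+ y)) (containingU-△ G) (sym (missingN-△ G)) ⟩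
    (containingU H ℕ.+ touchingN G) ℕ.+ (touchingN H ℕ.+ missingN G)
      ≡⟨ interchange (containingU H) (touchingN G) (touchingN H) (missingN G) ⟩
    (containingU H ℕ.+ touchingN H) ℕ.+ (touchingN G ℕ.+ missingN G)
      ≡⟨ +-comm (containingU H ℕ.+ touchingN H) (touchingN G ℕ.+ missingN G) ⟩
    (touchingN G ℕ.+ missingN G) ℕ.+ (containingU H ℕ.+ touchingN H)
      ≡⟨ sym (cong₂ ℕ._+_ (domCount-deleted-split G) (domCount-split H)) ⟩
    domCount (G ─ u) k ℕ.+ domCount H k ∎
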